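{- Let $q$ be a prime power, $n\ge 2$, $f(x)=\sum_{i=0}^{n-1}a_ix^{q^i}$ with $a_i\in\mathbb{F}_{q^n}$, and let $A$ be its Dickson matrix. If $A$ is reducible, then $f$ is $\mathbb{F}_{q^d}$-linear for some divisor $d>1$ of $n$.
   Context: The Dickson matrix of $f$ is the $n\times n$ matrix $A$ indexed by $\mathbb{Z}_n$ with $A[i|j]=a_{j-i}^{q^i}$. $A$ is reducible if there is a partition $\{\alpha,\beta\}$ of $\mathbb{Z}_n$ into two nonempty sets such that the submatrix $A[\alpha|\beta]$ (rows in $\alpha$, columns in $\beta$) is the zero matrix. -}

module Defs where

open import Level using (Level; _⊔_) renaming (suc to lsuc)
open import Data.Nat using (ℕ; zero; suc; _∸_; _^_; _≤_) renaming (_+_ to _+ℕ_)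
open import Data.Nat.DivMod using (_mod_)
open import Data.Nat.Primality using (Prime)
open import Data.Fin using (Fin; toℕ)
import Data.Fin as Fin
open import Data.Fin.Subset using (Subset; _∈_; _∉_; Nonempty; ∁)
open import Data.Product using (Σ; ∃; _×_)
open import Relation.Nullary using (¬_)
open import Relation.Binary.PropositionalEquality as ≡ using (_≡_)
open import Algebra.Bundles using (CommutativeRing)
open import Function.Bundles using (Inverse)

IsPrimePower : ℕ → Set
IsPrimePower q = Σ ℕ λ p → Σ ℕ λ k → Prime p × 1 ≤ k × q ≡ p ^ k

record Field (c ℓ : Level) : Set (lsuc (c ⊔ ℓ)) where
  field
    commRing   : CommutativeRing c ℓ
  open CommutativeRing commRing public
  field
    nontrivial : ¬ (1# ≈ 0#)
    inverse    : ∀ x → ¬ (x ≈ 0#) → ∃ λ y → x * y ≈ 1#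

module _ {c ℓ : Level} (K : Field c ℓ) where
  open Field K

  HasCard : ℕ → Set (c ⊔ ℓ)
  HasCard N = Inverse (≡.setoid (Fin N)) setoid

  pow : Carrier → ℕ → Carrier
  pow x zero    = 1#
  pow x (suc k) = x * pow x k

  sumFin : ∀ {n} → (Fin n → Carrier) → Carrier
  sumFin {zero}  g = 0#
  sumFin {suc n} g = g Fin.zero + sumFin {n} (λ i → g (Fin.suc i))

  linPoly : (q n : ℕ) → (Fin n → Carrier) → Carrier → Carrier
  linPoly q n a x = sumFin {n} (λ i → a i * pow x (q ^ toℕ i))

  -- f is F_{q^d}-linear, where F_{q^d} = { λ ∈ K | λ^{q^d} = λ }
  IsLinearOver : (q d : ℕ) → (Carrier → Carrier) → Set (c ⊔ ℓ)
  IsLinearOver q d f =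
    (∀ x y → f (x + y) ≈ f x + f y) ×
    (∀ λ' → pow λ' (q ^ d) ≈ λ' → ∀ x → f (λ' * x) ≈ λ' * f x)

subMod : ∀ {n} → Fin n → Fin n → Fin n
subMod {zero}  ()
subMod {suc m} j i = (toℕ j +ℕ (suc m ∸ toℕ i)) mod (suc m)

module _ {c ℓ : Level} (K : Field c ℓ) where
  open Field K

  dickson : (q n : ℕ) → (Fin n → Carrier) → Fin n → Fin n → Carrier
  dickson q n a i j = pow K (a (subMod j i)) (q ^ toℕ i)

  Reducible : ∀ {n} → (Fin n → Fin n → Carrier) → Set ℓ
  Reducible {n} A = Σ (Subset n) λ α →
    Nonempty α × Nonempty (∁ α) × (∀ i j → i ∈ α → j ∉ α → A i j ≈ 0#)

-- If A[α|∁α] = 0 and a_k ≠ 0, then for i ∈ α the entry A[i | i + k] = a_k^{q^i} is nonzero, so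
-- i + k ∈ α: every index k in the support of f is a translation of ℤ_n leaving α invariant.
-- The invariant translations of a nonempty proper α ⊆ ℤ_n are the multiples of the least positive
-- one, d, which divides n and exceeds 1. Hence f only involves the monomials x^{q^i} with d ∣ i,
-- which are F_{q^d}-linear: λ^{q^i} = λ for λ ∈ F_{q^d}, and x ↦ x^{q^i} is additive because K,
-- having p^{kn} elements, has characteristic p (counting gives |K| · 1 = 0).

module Submission where

open import Defs
open import Level using (Level)
open import Data.Nat.Base using (ℕ)
open import Data.Fin.Base using (Fin; toℕ)
open import Data.Product using (∃; _,_)
open import Data.Sum using (_⊎_; inj₁; inj₂)
open import Data.Empty using (⊥-elim)
open import Relation.Nullary using (¬_; Dec; yes; no)
open import Function.Base using (_∘_)
open import Relation.Binary.PropositionalEquality as ≡ using (_≡_)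
open import Algebra.Bundles using (Semiring; CommutativeSemiring; Ring)
open import Function.Bundles using (Inverse)

module PrimeBinomial where
  open import Data.Nat
  open import Data.Nat.Properties
  open import Data.Nat.Divisibility
  open import Data.Nat.Primality
  open import Data.Nat.Combinatorics
  open import Data.Nat.DivMod using (m/n*n≡m)
  open ≡ using (subst; sym; trans; cong)

  prime∤! : ∀ {p} → Prime p → ∀ m → m < p → ¬ p ∣ m !
  prime∤! p-prime zero    _   p∣1 = ¬prime[1] (subst Prime (∣1⇒≡1 p∣1) p-prime)
  prime∤! p-prime (suc m) m<p p∣m! with euclidsLemma (suc m) (m !) p-prime p∣m!
  ... | inj₁ p∣1+m = <⇒≱ m<p (∣⇒≤ p∣1+m)
  ... | inj₂ p∣m!′ = prime∤! p-prime m (<-trans (n<1+n m) m<p) p∣m!′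

  nCk*k!*[n∸k]!≡n! : ∀ {n k} → k ≤ n → (n C k) * (k ! * (n ∸ k) !) ≡ n !
  nCk*k!*[n∸k]!≡n! {n} {k} k≤n =
    trans (cong (_* (k ! * (n ∸ k) !)) (nCk≡n!/k![n-k]! k≤n))
          (m/n*n≡m {{k !* (n ∸ k) !≢0}} (k![n∸k]!∣n! k≤n))

  prime∣pCk : ∀ {p k} → Prime p → 0 < k → k < p → p ∣ p C k
  prime∣pCk {p@(suc p-1)} {k} p-prime 0<k k<p
    with euclidsLemma (p C k) (k ! * (p ∸ k) !) p-prime
           (subst (p ∣_) (sym (nCk*k!*[n∸k]!≡n! (<⇒≤ k<p))) (m∣m*n (p-1 !)))
  ... | inj₁ p∣pCk = p∣pCk
  ... | inj₂ p∣k!*[p∸k]! with euclidsLemma (k !) ((p ∸ k) !) p-prime p∣k!*[p∸k]!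
  ...   | inj₁ p∣k!     = ⊥-elim (prime∤! p-prime k k<p p∣k!)
  ...   | inj₂ p∣[p∸k]! = ⊥-elim (prime∤! p-prime (p ∸ k) (∸-monoʳ-< 0<k (<⇒≤ k<p)) p∣[p∸k]!)

module SemiringExp {c ℓ} (R : Semiring c ℓ) where
  open import Data.Nat as ℕ using (zero; suc)
  open Semiring R
  open import Relation.Binary.Reasoning.Setoid setoid
  open import Algebra.Properties.Semiring.Exp R
  open import Algebra.Properties.Semiring.Mult R using (_×_; ×1-homo-*)

  ^-fixed⇒^-power-fixed : ∀ {x m} → x ^ m ≈ x → ∀ u → x ^ (m ℕ.^ u) ≈ x
  ^-fixed⇒^-power-fixed {x} {m} xᵐ≈x zero    = *-identityʳ x
  ^-fixed⇒^-power-fixed {x} {m} xᵐ≈x (suc u) = begin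
    x ^ (m ℕ.* m ℕ.^ u)  ≈⟨ ^-assocʳ x m (m ℕ.^ u) ⟨
    (x ^ m) ^ (m ℕ.^ u)  ≈⟨ ^-congˡ (m ℕ.^ u) xᵐ≈x ⟩
    x ^ (m ℕ.^ u)        ≈⟨ ^-fixed⇒^-power-fixed xᵐ≈x u ⟩
    x                    ∎

  ×1-homo-^ : ∀ p m → (p ℕ.^ m) × 1# ≈ (p × 1#) ^ m
  ×1-homo-^ p zero    = +-identityʳ 1#
  ×1-homo-^ p (suc m) = trans (×1-homo-* p (p ℕ.^ m)) (*-congˡ (×1-homo-^ p m))

module Frobenius {c ℓ} (R : CommutativeSemiring c ℓ) where
  open import Data.Nat as ℕ using (zero; suc; _<_; z≤n; s≤s)
  open import Data.Nat.Properties using (suc-pred; n∸n≡0)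
  open import Data.Nat.Divisibility using (_∣_; divides)
  open import Data.Nat.Primality using (Prime; prime⇒nonZero)
  open import Data.Nat.Combinatorics using (_C_; nCn≡1)
  open import Data.Fin.Base using (zero; suc; fromℕ)
  open import Data.Fin.Properties using (toℕ-fromℕ; toℕ-inject₁; toℕ<n)
  open import Data.Vec.Functional using (init; last; tail)
  open CommutativeSemiring R hiding (zero)
  open import Relation.Binary.Reasoning.Setoid setoid
  open import Algebra.Properties.Semiring.Mult semiring
  open import Algebra.Properties.Semiring.Exp semiring
  open import Algebra.Properties.Semiring.Sum semiring using (sum; sum-cong-≋; sum-init-last; sum-replicate-zero)
  import Algebra.Properties.CommutativeSemiring.Binomial R as Binomial
  open PrimeBinomial using (prime∣pCk)

  module _ {p : ℕ} (p-prime : Prime p) (char-p : p × 1# ≈ 0#) where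

    p∣k⇒k×x≈0 : ∀ {k} → p ∣ k → ∀ x → k × x ≈ 0#
    p∣k⇒k×x≈0 {k} (divides m ≡.refl) x = begin
      k × x                    ≈⟨ ×-congʳ k (*-identityˡ x) ⟨
      k × (1# * x)             ≈⟨ ×-assoc-* k 1# x ⟨
      (k × 1#) * x             ≈⟨ *-congʳ (×1-homo-* m p) ⟩
      (m × 1#) * (p × 1#) * x  ≈⟨ *-congʳ (*-congˡ char-p) ⟩
      (m × 1#) * 0# * x        ≈⟨ *-congʳ (zeroʳ (m × 1#)) ⟩
      0# * x                   ≈⟨ zeroˡ x ⟩
      0#                       ∎

    binomialTerm≈0 : ∀ x y (k : Fin (suc p)) → 0 < toℕ k → toℕ k < p →
                     Binomial.binomialTerm x y p k ≈ 0#
    binomialTerm≈0 x y k 0<k k<p = p∣k⇒k×x≈0 (prime∣pCk p-prime 0<k k<p) _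

    ^p-distrib-+ : ∀ x y → (x + y) ^ p ≈ x ^ p + y ^ p
    ^p-distrib-+ x y = expand (≡.sym (suc-pred p {{prime⇒nonZero p-prime}}))
      where
      t : Fin (suc p) → Carrier
      t = Binomial.binomialTerm x y p

      expand : ∀ {p-1} → p ≡ suc p-1 → (x + y) ^ p ≈ x ^ p + y ^ p
      expand {p-1} ≡.refl = begin
        (x + y) ^ p                                    ≈⟨ Binomial.theorem p x y ⟩
        t zero + sum (tail t)                          ≈⟨ +-congˡ (sum-init-last (tail t)) ⟩
        t zero + (sum (init (tail t)) + last (tail t)) ≈⟨ +-cong firstTerm (+-cong middle≈0 lastTerm) ⟩
        y ^ p + (0# + x ^ p)                           ≈⟨ +-comm _ _ ⟩
        (0# + x ^ p) + y ^ p                           ≈⟨ +-congʳ (+-identityˡ _) ⟩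
        x ^ p + y ^ p                                  ∎
        where
        firstTerm : t zero ≈ y ^ p
        firstTerm = trans (+-identityʳ _) (*-identityˡ _)

        middle≈0 : sum (init (tail t)) ≈ 0#
        middle≈0 = trans (sum-cong-≋ {p-1} λ j → binomialTerm≈0 x y _ (s≤s z≤n)
                           (s≤s (≡.subst (ℕ._< p-1) (≡.sym (toℕ-inject₁ j)) (toℕ<n j))))
                         (sum-replicate-zero p-1)

        lastTerm : last (tail t) ≈ x ^ p
        lastTerm = begin
          (p C toℕ k) × (x ^ toℕ k * y ^ (p ℕ.∸ toℕ k))
            ≡⟨ ≡.cong (λ i → (p C i) × (x ^ i * y ^ (p ℕ.∸ i))) (≡.cong suc (toℕ-fromℕ p-1)) ⟩
          (p C p) × (x ^ p * y ^ (p ℕ.∸ p))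
            ≡⟨ ≡.cong₂ (λ c e → c × (x ^ p * y ^ e)) (nCn≡1 p) (n∸n≡0 p) ⟩
          1 × (x ^ p * 1#)   ≈⟨ +-identityʳ _ ⟩
          x ^ p * 1#         ≈⟨ *-identityʳ _ ⟩
          x ^ p              ∎
          where
          k : Fin (suc p)
          k = suc (fromℕ p-1)

    ^pᵐ-distrib-+ : ∀ m x y → (x + y) ^ (p ℕ.^ m) ≈ x ^ (p ℕ.^ m) + y ^ (p ℕ.^ m)
    ^pᵐ-distrib-+ zero    x y = trans (*-identityʳ _) (sym (+-cong (*-identityʳ x) (*-identityʳ y)))
    ^pᵐ-distrib-+ (suc m) x y = begin
      (x + y) ^ (p ℕ.* p ℕ.^ m)                ≈⟨ ^-assocʳ _ p (p ℕ.^ m) ⟨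
      ((x + y) ^ p) ^ (p ℕ.^ m)                ≈⟨ ^-congˡ (p ℕ.^ m) (^p-distrib-+ x y) ⟩
      (x ^ p + y ^ p) ^ (p ℕ.^ m)              ≈⟨ ^pᵐ-distrib-+ m _ _ ⟩
      (x ^ p) ^ (p ℕ.^ m) + (y ^ p) ^ (p ℕ.^ m) ≈⟨ +-cong (^-assocʳ x p _) (^-assocʳ y p _) ⟩
      x ^ (p ℕ.* p ℕ.^ m) + y ^ (p ℕ.* p ℕ.^ m) ∎

module FiniteRing {c ℓ} (R : Ring c ℓ) {N : ℕ} (enumeration : Inverse (≡.setoid (Fin N)) (Ring.setoid R)) where
  open Ring R
  open Inverse enumeration
  open import Relation.Binary.Reasoning.Setoid setoid
  open import Data.Fin.Properties using (_≟_)
  open import Data.Fin.Permutation using (permutation)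
  open import Data.Vec.Functional using (replicate)
  open import Algebra.Properties.Monoid.Mult +-monoid using (_×_)
  open import Algebra.Properties.Group +-group using (identityʳ-unique)
  open import Algebra.Properties.CommutativeMonoid.Sum +-commutativeMonoid
    using (sum; ∑-permute; ∑-distrib-+; sum-cong-≋; sum-replicate)

  ≈-dec : ∀ x y → Dec (x ≈ y)
  ≈-dec x y with from x ≟ from y
  ... | yes eq = yes (begin
    x             ≈⟨ strictlyInverseˡ x ⟨
    to (from x)   ≡⟨ ≡.cong to eq ⟩
    to (from y)   ≈⟨ strictlyInverseˡ y ⟩
    y             ∎)
  ... | no neq = no (λ x≈y → neq (from-cong x≈y))

  -- Translation by x permutes R, so Σ y = Σ (y + x) = Σ y + N × x.
  card×≈0 : ∀ x → N × x ≈ 0#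
  card×≈0 x = identityʳ-unique (sum to) (N × x) (begin
    sum to + N × x                    ≈⟨ +-congˡ (sum-replicate N) ⟨
    sum to + sum (replicate N x)      ≈⟨ ∑-distrib-+ to (λ _ → x) ⟨
    sum (λ i → to i + x)              ≈⟨ sum-cong-≋ {N} (λ i → strictlyInverseˡ (to i + x)) ⟨
    sum (λ i → to (τ i))              ≈⟨ ∑-permute to (permutation τ τ⁻¹ τ∘τ⁻¹ τ⁻¹∘τ) ⟨
    sum to                            ∎)
    where
    τ τ⁻¹ : Fin N → Fin N
    τ i   = from (to i + x)
    τ⁻¹ i = from (to i - x)
    cancel : ∀ {a b} → a + b ≈ 0# → ∀ i → from (to (from (to i + a)) + b) ≡ i
    cancel a+b≈0 i = ≡.trans (from-cong (trans (+-congʳ (strictlyInverseˡ _))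
                       (trans (+-assoc _ _ _) (trans (+-congˡ a+b≈0) (+-identityʳ _)))))
                     (strictlyInverseʳ i)
    τ∘τ⁻¹ : ∀ i → τ (τ⁻¹ i) ≡ i
    τ∘τ⁻¹ = cancel (-‿inverseˡ x)
    τ⁻¹∘τ : ∀ i → τ⁻¹ (τ i) ≡ i
    τ⁻¹∘τ = cancel (-‿inverseʳ x)

module FieldProperties {c ℓ} (K : Field c ℓ) where
  open import Data.Nat as ℕ using (zero; suc)
  open import Data.Nat.Properties using (^-*-assoc) renaming (*-comm to ℕ-*-comm)
  open import Data.Nat.Divisibility using (_∣_; divides)
  import Data.Fin.Base as Fin
  open Field K hiding (zero)
  open import Relation.Binary.Reasoning.Setoid setoid
  open import Algebra.Properties.Semiring.Mult semiring using () renaming (_×_ to _·_)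
  open import Algebra.Properties.Semiring.Exp semiring using (_^_)
  open import Algebra.Properties.CommutativeSemiring.Exp commutativeSemiring using (^-distrib-*)
  open import Algebra.Properties.CommutativeSemigroup *-commutativeSemigroup using (x∙yz≈y∙xz)
  open import Algebra.Properties.Semiring.Sum semiring
    using (sum; sum-cong-≋; sum-cong-≗; ∑-distrib-+; *-distribˡ-sum)
  open SemiringExp semiring using (^-fixed⇒^-power-fixed; ×1-homo-^)

  pow≡^ : ∀ x m → pow K x m ≡ x ^ m
  pow≡^ x zero    = ≡.refl
  pow≡^ x (suc m) = ≡.cong (x *_) (pow≡^ x m)

  sumFin≡sum : ∀ {n} (g : Fin n → Carrier) → sumFin K g ≡ sum g
  sumFin≡sum {zero}  g = ≡.refl
  sumFin≡sum {suc n} g = ≡.cong (g Fin.zero +_) (sumFin≡sum (λ i → g (Fin.suc i)))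

  *-≉0 : ∀ {x y} → ¬ x ≈ 0# → ¬ y ≈ 0# → ¬ x * y ≈ 0#
  *-≉0 {x} {y} x≉0 y≉0 xy≈0 with inverse x x≉0
  ... | x⁻¹ , xx⁻¹≈1 = y≉0 (begin
    y              ≈⟨ *-identityˡ y ⟨
    1# * y         ≈⟨ *-congʳ xx⁻¹≈1 ⟨
    (x * x⁻¹) * y  ≈⟨ *-congʳ (*-comm x x⁻¹) ⟩
    (x⁻¹ * x) * y  ≈⟨ *-assoc x⁻¹ x y ⟩
    x⁻¹ * (x * y)  ≈⟨ *-congˡ xy≈0 ⟩
    x⁻¹ * 0#       ≈⟨ zeroʳ x⁻¹ ⟩
    0#             ∎)

  ^-≉0 : ∀ {x} → ¬ x ≈ 0# → ∀ m → ¬ x ^ m ≈ 0#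
  ^-≉0 x≉0 zero    = nontrivial
  ^-≉0 x≉0 (suc m) = *-≉0 x≉0 (^-≉0 x≉0 m)

  pᵐ-elements⇒p·1≈0 : ∀ {p m} → HasCard K (p ℕ.^ m) → p · 1# ≈ 0#
  pᵐ-elements⇒p·1≈0 {p} {m} card with FiniteRing.≈-dec ring card (p · 1#) 0#
  ... | yes p·1≈0 = p·1≈0
  ... | no  p·1≉0 = ⊥-elim (^-≉0 p·1≉0 m (trans (sym (×1-homo-^ p m)) (FiniteRing.card×≈0 ring card 1#)))

  ^qᵉ-distrib-+ : ∀ {q m} → IsPrimePower q → HasCard K (q ℕ.^ m) →
                  ∀ e x y → (x + y) ^ (q ℕ.^ e) ≈ x ^ (q ℕ.^ e) + y ^ (q ℕ.^ e)
  ^qᵉ-distrib-+ {q} {m} (p , k , p-prime , _ , q≡pᵏ) card e x y =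
    ≡.subst (λ Q → (x + y) ^ Q ≈ x ^ Q + y ^ Q) (≡.sym (qʳ≡p^[k*r] e))
      (Frobenius.^pᵐ-distrib-+ commutativeSemiring p-prime
        (pᵐ-elements⇒p·1≈0 {p} {k ℕ.* m} (≡.subst (HasCard K) (qʳ≡p^[k*r] m) card)) (k ℕ.* e) x y)
    where
    qʳ≡p^[k*r] : ∀ r → q ℕ.^ r ≡ p ℕ.^ (k ℕ.* r)
    qʳ≡p^[k*r] r = ≡.trans (≡.cong (ℕ._^ r) q≡pᵏ) (^-*-assoc p k r)

  linPoly≈sum : ∀ {q n} (a : Fin n → Carrier) x →
                linPoly K q n a x ≈ sum (λ i → a i * x ^ (q ℕ.^ toℕ i))
  linPoly≈sum {q} {n} a x = begin
    linPoly K q n a x                          ≡⟨ sumFin≡sum (λ i → a i * pow K x (q ℕ.^ toℕ i)) ⟩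
    sum (λ i → a i * pow K x (q ℕ.^ toℕ i))    ≡⟨ sum-cong-≗ (λ i → ≡.cong (a i *_) (pow≡^ x (q ℕ.^ toℕ i))) ⟩
    sum (λ i → a i * x ^ (q ℕ.^ toℕ i))        ∎

  linPoly-isLinearOver : ∀ {q n d} (a : Fin n → Carrier) →
    (∀ e x y → (x + y) ^ (q ℕ.^ e) ≈ x ^ (q ℕ.^ e) + y ^ (q ℕ.^ e)) →
    (∀ i → a i ≈ 0# ⊎ d ∣ toℕ i) →
    IsLinearOver K q d (linPoly K q n a)
  linPoly-isLinearOver {q} {n} {d} a frobenius support = additive , homogeneous
    where
    f : Carrier → Carrier
    f = linPoly K q n a

    Q : Fin n → ℕ
    Q i = q ℕ.^ toℕ i

    term : Carrier → Fin n → Carrier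
    term x i = a i * x ^ Q i

    additive : ∀ x y → f (x + y) ≈ f x + f y
    additive x y = begin
      f (x + y)                              ≈⟨ linPoly≈sum a (x + y) ⟩
      sum (term (x + y))                     ≈⟨ sum-cong-≋ {n} (λ i → *-congˡ (frobenius (toℕ i) x y)) ⟩
      sum (λ i → a i * (x ^ Q i + y ^ Q i))  ≈⟨ sum-cong-≋ {n} (λ i → distribˡ (a i) _ _) ⟩
      sum (λ i → term x i + term y i)        ≈⟨ ∑-distrib-+ (term x) (term y) ⟩
      sum (term x) + sum (term y)            ≈⟨ +-cong (linPoly≈sum a x) (linPoly≈sum a y) ⟨
      f x + f y                              ∎

    homogeneous : ∀ l → pow K l (q ℕ.^ d) ≈ l → ∀ x → f (l * x) ≈ l * f x
    homogeneous l l-fixed x = begin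
      f (l * x)                 ≈⟨ linPoly≈sum a (l * x) ⟩
      sum (term (l * x))        ≈⟨ sum-cong-≋ {n} termwise ⟩
      sum (λ i → l * term x i)  ≈⟨ *-distribˡ-sum l (term x) ⟨
      l * sum (term x)          ≈⟨ *-congˡ (linPoly≈sum a x) ⟨
      l * f x                   ∎
      where
      termwise : ∀ i → term (l * x) i ≈ l * term x i
      termwise i with support i
      ... | inj₁ aᵢ≈0 = begin
        a i * (l * x) ^ Q i  ≈⟨ *-congʳ aᵢ≈0 ⟩
        0# * (l * x) ^ Q i   ≈⟨ zeroˡ _ ⟩
        0#                   ≈⟨ zeroʳ l ⟨
        l * 0#               ≈⟨ *-congˡ (trans (*-congʳ aᵢ≈0) (zeroˡ _)) ⟨
        l * term x i         ∎
      ... | inj₂ (divides u i≡u*d) = begin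
        a i * (l * x) ^ Q i        ≈⟨ *-congˡ (^-distrib-* l x (Q i)) ⟩
        a i * (l ^ Q i * x ^ Q i)  ≈⟨ *-congˡ (*-congʳ l^Qi≈l) ⟩
        a i * (l * x ^ Q i)        ≈⟨ x∙yz≈y∙xz (a i) l (x ^ Q i) ⟩
        l * term x i               ∎
        where
        Qi≡[qᵈ]ᵘ : Q i ≡ (q ℕ.^ d) ℕ.^ u
        Qi≡[qᵈ]ᵘ = ≡.trans (≡.cong (q ℕ.^_) (≡.trans i≡u*d (ℕ-*-comm u d))) (≡.sym (^-*-assoc q d u))
        l^Qi≈l : l ^ Q i ≈ l
        l^Qi≈l = ≡.subst (λ e → l ^ e ≈ l) (≡.sym Qi≡[qᵈ]ᵘ)
                   (^-fixed⇒^-power-fixed (trans (reflexive (≡.sym (pow≡^ l (q ℕ.^ d)))) l-fixed) u)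

module CyclicShift (n : ℕ) where
  open import Data.Nat
  open import Data.Nat.Properties
  open import Data.Nat.DivMod
  open import Data.Nat.Divisibility using (_∣_; m%n≡0⇒n∣m)
  open import Data.Nat.Tactic.RingSolver using (solve-∀)
  open import Data.Fin.Base using (fromℕ; fromℕ<)
  open import Data.Fin.Properties
    using (toℕ-fromℕ<; toℕ-fromℕ; toℕ-inject; toℕ-injective; toℕ<n; all?; ¬∀⟶∃¬-smallest)
  open import Data.Fin.Subset using (Subset; _∈_; _∉_)
  open import Data.Fin.Subset.Properties using (_∈?_)
  open import Data.Product using (_×_)
  open import Relation.Nullary.Decidable using (_→-dec_; ¬?; decidable-stable)
  open ≡ using (cong; sym; trans; subst)
  open ≡.≡-Reasoning

  private
    N : ℕ
    N = suc n

    %-absorbˡ : ∀ a b → (a % N + b) % N ≡ (a + b) % N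
    %-absorbˡ a b = begin
      (a % N + b) % N          ≡⟨ %-distribˡ-+ (a % N) b N ⟩
      (a % N % N + b % N) % N  ≡⟨ cong (λ x → (x + b % N) % N) (m%n%n≡m%n a N) ⟩
      (a % N + b % N) % N      ≡⟨ %-distribˡ-+ a b N ⟨
      (a + b) % N              ∎

    %-absorbʳ : ∀ a b → (a + b % N) % N ≡ (a + b) % N
    %-absorbʳ a b = begin
      (a + b % N) % N  ≡⟨ cong (_% N) (+-comm a (b % N)) ⟩
      (b % N + a) % N  ≡⟨ %-absorbˡ b a ⟩
      (b + a) % N      ≡⟨ cong (_% N) (+-comm b a) ⟩
      (a + b) % N      ∎

    a+bd+bmd≡a+bd[1+m] : ∀ a b d m → a + b * d + b * m * d ≡ a + b * d * suc m
    a+bd+bmd≡a+bd[1+m] = solve-∀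

    [i+x+[N∸i]]%N≡x%N : ∀ (i : Fin N) x → (toℕ i + x + (N ∸ toℕ i)) % N ≡ x % N
    [i+x+[N∸i]]%N≡x%N i x = begin
      (toℕ i + x + (N ∸ toℕ i)) % N    ≡⟨ cong (λ y → (y + (N ∸ toℕ i)) % N) (+-comm (toℕ i) x) ⟩
      (x + toℕ i + (N ∸ toℕ i)) % N    ≡⟨ cong (_% N) (+-assoc x (toℕ i) (N ∸ toℕ i)) ⟩
      (x + (toℕ i + (N ∸ toℕ i))) % N  ≡⟨ cong (λ y → (x + y) % N) (m+[n∸m]≡n (<⇒≤ (toℕ<n i))) ⟩
      (x + N) % N                      ≡⟨ [m+n]%n≡m%n x N ⟩
      x % N                            ∎

  shift : ℕ → Fin N → Fin N
  shift r i = (toℕ i + r) mod N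

  toℕ-shift : ∀ r i → toℕ (shift r i) ≡ (toℕ i + r) % N
  toℕ-shift r i = toℕ-fromℕ< _

  shift-0 : ∀ i → shift 0 i ≡ i
  shift-0 i = toℕ-injective (begin
    toℕ (shift 0 i)   ≡⟨ toℕ-shift 0 i ⟩
    (toℕ i + 0) % N   ≡⟨ cong (_% N) (+-identityʳ (toℕ i)) ⟩
    toℕ i % N         ≡⟨ m<n⇒m%n≡m (toℕ<n i) ⟩
    toℕ i             ∎)

  shift-+ : ∀ r s i → shift (r + s) i ≡ shift s (shift r i)
  shift-+ r s i = toℕ-injective (begin
    toℕ (shift (r + s) i)     ≡⟨ toℕ-shift (r + s) i ⟩
    (toℕ i + (r + s)) % N     ≡⟨ cong (_% N) (+-assoc (toℕ i) r s) ⟨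
    (toℕ i + r + s) % N       ≡⟨ %-absorbˡ (toℕ i + r) s ⟨
    ((toℕ i + r) % N + s) % N ≡⟨ cong (λ x → (x + s) % N) (toℕ-shift r i) ⟨
    (toℕ (shift r i) + s) % N ≡⟨ toℕ-shift s (shift r i) ⟨
    toℕ (shift s (shift r i)) ∎)

  shift-% : ∀ r i → shift (r % N) i ≡ shift r i
  shift-% r i = toℕ-injective (begin
    toℕ (shift (r % N) i)  ≡⟨ toℕ-shift (r % N) i ⟩
    (toℕ i + r % N) % N    ≡⟨ %-absorbʳ (toℕ i) r ⟩
    (toℕ i + r) % N        ≡⟨ toℕ-shift r i ⟨
    toℕ (shift r i)        ∎)

  subMod-shift : ∀ k i → subMod (shift (toℕ k) i) i ≡ k
  subMod-shift k i = toℕ-injective (begin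
    toℕ (subMod (shift (toℕ k) i) i)          ≡⟨ toℕ-fromℕ< _ ⟩
    (toℕ (shift (toℕ k) i) + (N ∸ toℕ i)) % N ≡⟨ cong (λ x → (x + (N ∸ toℕ i)) % N) (toℕ-shift (toℕ k) i) ⟩
    ((toℕ i + toℕ k) % N + (N ∸ toℕ i)) % N   ≡⟨ %-absorbˡ (toℕ i + toℕ k) (N ∸ toℕ i) ⟩
    (toℕ i + toℕ k + (N ∸ toℕ i)) % N         ≡⟨ [i+x+[N∸i]]%N≡x%N i (toℕ k) ⟩
    toℕ k % N                                 ≡⟨ m<n⇒m%n≡m (toℕ<n k) ⟩
    toℕ k                                     ∎)

  shift-subMod : ∀ j i → shift (toℕ (subMod j i)) i ≡ j
  shift-subMod j i = toℕ-injective (begin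
    toℕ (shift (toℕ (subMod j i)) i)           ≡⟨ toℕ-shift _ i ⟩
    (toℕ i + toℕ (subMod j i)) % N             ≡⟨ cong (λ x → (toℕ i + x) % N) (toℕ-fromℕ< _) ⟩
    (toℕ i + (toℕ j + (N ∸ toℕ i)) % N) % N    ≡⟨ %-absorbʳ (toℕ i) (toℕ j + (N ∸ toℕ i)) ⟩
    (toℕ i + (toℕ j + (N ∸ toℕ i))) % N        ≡⟨ cong (_% N) (+-assoc (toℕ i) (toℕ j) (N ∸ toℕ i)) ⟨
    (toℕ i + toℕ j + (N ∸ toℕ i)) % N          ≡⟨ [i+x+[N∸i]]%N≡x%N i (toℕ j) ⟩
    toℕ j % N                                  ≡⟨ m<n⇒m%n≡m (toℕ<n j) ⟩
    toℕ j                                      ∎)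

  ShiftInvariant : Subset N → ℕ → Set
  ShiftInvariant α r = ∀ i → i ∈ α → shift r i ∈ α

  shiftInvariant? : ∀ α r → Dec (ShiftInvariant α r)
  shiftInvariant? α r = all? λ i → i ∈? α →-dec shift r i ∈? α

  module _ {α : Subset N} where

    invariant-0 : ShiftInvariant α 0
    invariant-0 i i∈α = subst (_∈ α) (sym (shift-0 i)) i∈α

    invariant-+ : ∀ {r s} → ShiftInvariant α r → ShiftInvariant α s → ShiftInvariant α (r + s)
    invariant-+ {r} {s} inv-r inv-s i i∈α = subst (_∈ α) (sym (shift-+ r s i)) (inv-s _ (inv-r i i∈α))

    invariant-* : ∀ {d} → ShiftInvariant α d → ∀ u → ShiftInvariant α (u * d)
    invariant-* inv-d zero    = invariant-0
    invariant-* inv-d (suc u) = invariant-+ inv-d (invariant-* inv-d u)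

    invariant-cong : ∀ {r s} → r % N ≡ s % N → ShiftInvariant α r → ShiftInvariant α s
    invariant-cong {r} {s} r≡s inv-r i i∈α = subst (_∈ α) shift-r≡shift-s (inv-r i i∈α)
      where
      shift-r≡shift-s : shift r i ≡ shift s i
      shift-r≡shift-s = begin
        shift r i        ≡⟨ shift-% r i ⟨
        shift (r % N) i  ≡⟨ cong (λ x → shift x i) r≡s ⟩
        shift (s % N) i  ≡⟨ shift-% s i ⟩
        shift s i        ∎

    invariant-N : ShiftInvariant α N
    invariant-N = invariant-cong (sym (n%n≡0 N)) invariant-0

    -- t % d ≡ t + (t / d) * n * d (mod N), a sum of invariant shifts.
    invariant-% : ∀ {d t} .{{_ : NonZero d}} →
                  ShiftInvariant α d → ShiftInvariant α t → ShiftInvariant α (t % d)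
    invariant-% {d} {t} inv-d inv-t =
      invariant-cong t+[t/d*n]*d≡t%d (invariant-+ inv-t (invariant-* inv-d (t / d * n)))
      where
      t+[t/d*n]*d≡t%d : (t + t / d * n * d) % N ≡ t % d % N
      t+[t/d*n]*d≡t%d = begin
        (t + t / d * n * d) % N                    ≡⟨ cong (λ s → (s + t / d * n * d) % N) (m≡m%n+[m/n]*n t d) ⟩
        (t % d + t / d * d + t / d * n * d) % N    ≡⟨ cong (_% N) (a+bd+bmd≡a+bd[1+m] (t % d) (t / d) d n) ⟩
        (t % d + t / d * d * N) % N                ≡⟨ [m+kn]%n≡m%n (t % d) (t / d * d) N ⟩
        t % d % N                                  ∎

    ¬invariant-1 : ∀ {i j} → i ∈ α → j ∉ α → ¬ ShiftInvariant α 1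
    ¬invariant-1 {i} {j} i∈α j∉α inv-1 = j∉α (subst (_∈ α) (shift-subMod j i) (inv-r i i∈α))
      where
      inv-r : ShiftInvariant α (toℕ (subMod j i))
      inv-r = subst (ShiftInvariant α) (*-identityʳ _) (invariant-* inv-1 (toℕ (subMod j i)))

    least-invariant : ∃ λ d → ShiftInvariant α (suc d) × (∀ e → e < d → ¬ ShiftInvariant α (suc e))
    least-invariant
      with ¬∀⟶∃¬-smallest N (¬_ ∘ ShiftInvariant α ∘ suc ∘ toℕ) (λ e → ¬? (shiftInvariant? α (suc (toℕ e))))
             (λ none → none (fromℕ n) (subst (ShiftInvariant α ∘ suc) (sym (toℕ-fromℕ n)) invariant-N))
    ... | d , ¬¬inv-d , smaller = toℕ d , decidable-stable (shiftInvariant? α _) ¬¬inv-d , λ e e<d →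
          subst (¬_ ∘ ShiftInvariant α ∘ suc) (trans (toℕ-inject (fromℕ< e<d)) (toℕ-fromℕ< e<d))
                (smaller (fromℕ< e<d))

    invariant-period : ∀ {i j} → i ∈ α → j ∉ α →
                       ∃ λ d → d ∣ N × 1 < d × (∀ {t} → ShiftInvariant α t → d ∣ t)
    invariant-period i∈α j∉α with least-invariant
    ... | zero    , inv-1 , _       = ⊥-elim (¬invariant-1 i∈α j∉α inv-1)
    ... | suc d-2 , inv-d , minimal = d , period∣ invariant-N , s≤s (s≤s z≤n) , period∣
      where
      d : ℕ
      d = suc (suc d-2)
      period∣ : ∀ {t} → ShiftInvariant α t → d ∣ t
      period∣ {t} inv-t with t % d in t%d≡r
      ... | zero  = m%n≡0⇒n∣m t d t%d≡r
      ... | suc r = ⊥-elim (minimal r (≤-pred (subst (_< d) t%d≡r (m%n<n t d)))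
                      (subst (ShiftInvariant α) t%d≡r (invariant-% inv-d inv-t)))

module DicksonMatrix {c ℓ} (K : Field c ℓ) {n : ℕ} where
  open Field K
  open import Data.Nat as ℕ using (suc)
  open import Data.Fin.Subset using (Subset; _∈_; _∉_)
  open import Data.Fin.Subset.Properties using (_∈?_)
  open FieldProperties K using (pow≡^; ^-≉0)
  open CyclicShift n using (ShiftInvariant; shift; subMod-shift)

  zero-block⇒support-invariant : ∀ {q} (a : Fin (suc n) → Carrier) (α : Subset (suc n)) →
    (∀ i j → i ∈ α → j ∉ α → dickson K q (suc n) a i j ≈ 0#) →
    ∀ k → ¬ a k ≈ 0# → ShiftInvariant α (toℕ k)
  zero-block⇒support-invariant {q} a α A[α|∁α]≈0 k aₖ≉0 i i∈α with shift (toℕ k) i ∈? α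
  ... | yes i+k∈α = i+k∈α
  ... | no  i+k∉α = ⊥-elim (^-≉0 aₖ≉0 Q (trans (reflexive (≡.sym (pow≡^ (a k) Q))) aₖ^Q≈0))
    where
    Q : ℕ
    Q = q ℕ.^ toℕ i
    aₖ^Q≈0 : pow K (a k) Q ≈ 0#
    aₖ^Q≈0 = ≡.subst (λ l → pow K (a l) Q ≈ 0#) (subMod-shift k i) (A[α|∁α]≈0 i _ i∈α i+k∉α)

open import Data.Nat using (_≤_; _<_; _^_; suc; s≤s)
open import Data.Nat.Divisibility using (_∣_)
open import Data.Fin.Subset.Properties using (x∈∁p⇒x∉p)
open import Data.Product using (Σ; _×_)
open FiniteRing using (≈-dec)
open FieldProperties using (linPoly-isLinearOver; ^qᵉ-distrib-+)
open DicksonMatrix using (zero-block⇒support-invariant)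

mainTheorem11 : {c ℓ : Level} (K : Field c ℓ) (q n : ℕ) →
    IsPrimePower q → 2 ≤ n → HasCard K (q ^ n) →
    (a : Fin n → Field.Carrier K) →
    Reducible K (dickson K q n a) →
    Σ ℕ λ d → d ∣ n × 1 < d × IsLinearOver K q d (linPoly K q n a)
mainTheorem11 K q (suc n) q-prime-power (s≤s _) card a (α , (i , i∈α) , (j , j∈∁α) , A[α|∁α]≈0)
  with CyclicShift.invariant-period n i∈α (x∈∁p⇒x∉p j∈∁α)
... | d , d∣n , 1<d , period∣ =
  d , d∣n , 1<d , linPoly-isLinearOver K a (^qᵉ-distrib-+ K {m = suc n} q-prime-power card) support
  where
  open Field K using (_≈_; 0#; ring)
  support : ∀ k → a k ≈ 0# ⊎ d ∣ toℕ k
  support k with ≈-dec ring card (a k) 0#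
  ... | yes aₖ≈0 = inj₁ aₖ≈0
  ... | no  aₖ≉0 = inj₂ (period∣ (zero-block⇒support-invariant K a α A[α|∁α]≈0 k aₖ≉0))
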